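{- For any tree $T$ of order $n\ge 2$, $1\le \chi_i'(T)\le 3$.
   Context: Three edges $e_1,e_2,e_3$ (in this order) of a graph are consecutive if $e_1=xy$, $e_2=yz$, $e_3=zu$ for some vertices $x,y,z,u$ (where $x=u$ is allowed). An injective edge coloring of $G$ is a map $c:E(G)\to\mathcal{C}$ such that whenever $e_1,e_2,e_3$ are consecutive edges, $c(e_1)\neq c(e_3)$. $\chi_i'(G)$ is the minimum number of colors in an injective edge coloring of $G$. -}

module Defs where

open import Data.Nat using (ℕ; zero; suc; _<_)
open import Data.Fin using (Fin; zero; suc; inject₁; fromℕ)
open import Data.Product using (_×_; Σ)
open import Relation.Nullary using (¬_)
open import Relation.Binary.PropositionalEquality using (_≡_; _≢_)
open import Relation.Binary.Construct.Closure.ReflexiveTransitive using (Star)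
open import Function.Definitions using (Injective)

record SimpleGraph (n : ℕ) : Set₁ where
  field
    Adj    : Fin n → Fin n → Set
    sym    : ∀ {x y} → Adj x y → Adj y x
    irrefl : ∀ {x} → ¬ Adj x x
open SimpleGraph public

Connected : ∀ {n} → SimpleGraph n → Set
Connected G = ∀ x y → Star (Adj G) x y

-- A cycle of length m+3: distinct vertices v₀,…,v_{m+2} with
-- vᵢ ~ vᵢ₊₁ and v_{m+2} ~ v₀.
record Cycle {n : ℕ} (G : SimpleGraph n) : Set where
  field
    m      : ℕ
    v      : Fin (suc (suc (suc m))) → Fin n
    inj    : Injective _≡_ _≡_ v
    step   : ∀ (i : Fin (suc (suc m))) → Adj G (v (inject₁ i)) (v (suc i))
    close  : Adj G (v (fromℕ (suc (suc m)))) (v zero)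

Acyclic : ∀ {n} → SimpleGraph n → Set
Acyclic G = ¬ Cycle G

IsTree : ∀ {n} → SimpleGraph n → Set
IsTree G = Connected G × Acyclic G

record EdgeColoring {n : ℕ} (G : SimpleGraph n) (k : ℕ) : Set where
  field
    col  : ∀ x y → Adj G x y → Fin k
    symm : ∀ x y (p : Adj G x y) (q : Adj G y x) → col x y p ≡ col y x q
open EdgeColoring public

-- Injective: for consecutive edges xy, yz, zu (three edges, so x ≠ z and
-- y ≠ u; x = u allowed) the colours of xy and zu differ.
IsInjective : ∀ {n k} {G : SimpleGraph n} → EdgeColoring G k → Set
IsInjective {G = G} c =
  ∀ x y z u (p : Adj G x y) (q : Adj G y z) (r : Adj G z u) →
  x ≢ z → y ≢ u → col c x y p ≢ col c z u r

InjColorable : ∀ {n} → SimpleGraph n → ℕ → Set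
InjColorable G k = Σ (EdgeColoring G k) IsInjective

IsInjChromaticIndex : ∀ {n} → SimpleGraph n → ℕ → Set
IsInjChromaticIndex G k = InjColorable G k × (∀ j → j < k → ¬ InjColorable G j)

-- Root the tree and let depth v be the distance from v to the
-- root.  Colour an edge xy by (max (depth x) (depth y)) mod 3.  Along an edge
-- the depth changes by exactly ±1, and no vertex has two neighbours one level
-- closer to the root (both facts fail only in the presence of a cycle).  Hence
-- for consecutive edges xy, yz, zu with x ≠ z and y ≠ u the depth profile has
-- no peak at y or z, so it is monotone or a single valley, and the levels of
-- xy and zu differ by 1 or 2: their colours differ.
--
-- Adjacency in a tree is decidable (a walk reduces to a path; a
-- path of length ≥ 2 plus an edge would close a cycle), so injective
-- k-colourability is decidable by exhaustive search over colour tables; the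
-- least number principle then gives the minimum k ≤ 3.  It is ≥ 1 because a
-- connected graph on two or more vertices has an edge.
module Submission where

open import Data.Nat using (ℕ; zero; suc; _+_; _≤_; _<_; _⊔_; z≤n; s≤s)
open import Data.Nat.Properties
  using (≤-reflexive; ≤-trans; ≤-antisym; n≤1+n; <⇒≢; ≮⇒≥; <-cmp; +-suc; +-identityʳ;
         m<1+n⇒m<n∨m≡n; m≤n⇒m⊔n≡n; m≥n⇒m⊔n≡m; ⊔-comm; ≤-pred; suc-injective)
open import Data.Fin using (Fin; zero; suc; inject₁; fromℕ; opposite; _≟_)
open import Data.Fin.Properties using (any?; all?; opposite-involutive)
import Data.Fin.Properties as Fin
open import Data.Vec using (Vec; []; _∷_; lookup; tabulate)
open import Data.Vec.Properties using (lookup∘tabulate)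
open import Data.Product using (_×_; Σ; _,_; ∃; ∃-syntax; proj₁; proj₂)
open import Data.Sum using ([_,_])
open import Data.Empty using (⊥; ⊥-elim)
open import Function using (_∘_)
open import Function.Definitions using (Injective)
open import Relation.Nullary using (¬_; Dec; yes; no; contradiction)
open import Relation.Nullary.Decidable using (_×-dec_; _→-dec_; ¬?; map′)
open import Relation.Binary.PropositionalEquality
  using (_≡_; _≢_; refl; sym; trans; cong; subst; subst₂)
open import Relation.Binary.Definitions using (tri<; tri≈; tri>)
open import Relation.Binary.Construct.Closure.ReflexiveTransitive using (Star; ε; _◅_)
open import Defs renaming (sym to adj-sym)

-- Reversing a path re-indexes its vertices by `opposite`; this is how
-- `opposite` interacts with the two embeddings Fin m → Fin (suc m).
opposite-inject₁ : ∀ {m} (i : Fin m) → opposite (inject₁ i) ≡ suc (opposite i)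
opposite-inject₁ zero    = refl
opposite-inject₁ (suc i) = cong inject₁ (opposite-inject₁ i)

opposite-fromℕ : ∀ m → opposite (fromℕ m) ≡ zero
opposite-fromℕ m = opposite-involutive zero

module Paths {n : ℕ} (G : SimpleGraph n) where

  record Path (m : ℕ) (a c : Fin n) : Set where
    field
      vertex   : Fin (suc m) → Fin n
      distinct : Injective _≡_ _≡_ vertex
      step     : ∀ i → Adj G (vertex (inject₁ i)) (vertex (suc i))
      start    : vertex zero ≡ a
      end      : vertex (fromℕ m) ≡ c
  open Path public

  adj-distinct : ∀ {x y} → Adj G x y → x ≢ y
  adj-distinct e refl = irrefl G e

  Avoids : ∀ {m a c} → Path m a c → Fin n → Set
  Avoids P w = ∀ i → vertex P i ≢ w

  trivial : ∀ a → Path 0 a a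
  trivial a = record
    { vertex = λ _ → a ; distinct = λ { {zero} {zero} _ → refl } ; step = λ ()
    ; start = refl ; end = refl }

  cons : ∀ {m a a′ c} → Adj G a′ a → (P : Path m a c) → Avoids P a′ → Path (suc m) a′ c
  cons {a′ = a′} e P fresh = record
    { vertex = vertex′ ; distinct = distinct′ ; step = step′ ; start = refl ; end = end P }
    where
      vertex′ : Fin _ → Fin n
      vertex′ zero    = a′
      vertex′ (suc i) = vertex P i
      distinct′ : Injective _≡_ _≡_ vertex′
      distinct′ {zero}  {zero}  _  = refl
      distinct′ {zero}  {suc j} eq = ⊥-elim (fresh j (sym eq))
      distinct′ {suc i} {zero}  eq = ⊥-elim (fresh i eq)
      distinct′ {suc i} {suc j} eq = cong suc (distinct P eq)
      step′ : ∀ i → Adj G (vertex′ (inject₁ i)) (vertex′ (suc i))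
      step′ zero    = subst (Adj G a′) (sym (start P)) e
      step′ (suc i) = step P i

  reverse : ∀ {m a c} → Path m a c → Path m c a
  reverse {m} P = record
    { vertex   = vertex P ∘ opposite
    ; distinct = λ eq → trans (sym (opposite-involutive _))
                              (trans (cong opposite (distinct P eq)) (opposite-involutive _))
    ; step     = λ i → subst (λ j → Adj G (vertex P j) (vertex P (inject₁ (opposite i))))
                             (sym (opposite-inject₁ i)) (adj-sym G (step P (opposite i)))
    ; start    = end P
    ; end      = trans (cong (vertex P) (opposite-fromℕ m)) (start P) }

  tail : ∀ {m a c} (P : Path (suc m) a c) → Path m (vertex P (suc zero)) c
  tail P = record
    { vertex = vertex P ∘ suc ; distinct = Fin.suc-injective ∘ distinct P
    ; step = step P ∘ suc ; start = refl ; end = end P }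

  suffix : ∀ {m a c} (P : Path m a c) (i : Fin (suc m)) → ∃[ k ] Path k (vertex P i) c
  suffix P zero = _ , record
    { vertex = vertex P ; distinct = distinct P ; step = step P ; start = refl ; end = end P }
  suffix {suc m} P (suc i) = suffix (tail P) i

  -- Every walk contains a path with the same ends: extend the path of the
  -- remaining walk, or cut it back to the first return to the new vertex.
  walk⇒path : ∀ {a c} → Star (Adj G) a c → ∃[ m ] Path m a c
  walk⇒path {a} ε = 0 , trivial a
  walk⇒path {a} {c} (e ◅ walk) with walk⇒path walk
  ... | m , P with any? (λ i → vertex P i ≟ a)
  ... | yes (i , at-a) = let (k , Q) = suffix P i in k , subst (λ x → Path k x c) at-a Q
  ... | no  a∉P        = suc m , cons e P (λ i eq → a∉P (i , eq))

  closes-cycle : Acyclic G → ∀ {m a c} → Path (suc (suc m)) a c → ¬ Adj G c a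
  closes-cycle acyclic {m} P e = acyclic record
    { m = m ; v = vertex P ; inj = distinct P ; step = step P
    ; close = subst₂ (Adj G) (sym (end P)) (sym (start P)) e }

  -- In a tree, x ~ y iff the path from x to y has length exactly 1.
  adjacency-decidable : Connected G → Acyclic G → ∀ x y → Dec (Adj G x y)
  adjacency-decidable connected acyclic x y with walk⇒path (connected x y)
  ... | zero , P = no λ e → irrefl G (subst (Adj G x) (sym (trans (sym (start P)) (end P))) e)
  ... | suc zero , P = yes (subst₂ (Adj G) (start P) (end P) (step P zero))
  ... | suc (suc m) , P = no λ e → closes-cycle acyclic P (adj-sym G e)

Least : (ℕ → Set) → ℕ → Set
Least P k = P k × (∀ j → j < k → ¬ P j)

-- Least number principle for decidable predicates: scan 0, 1, 2, … and stop
-- at the first success, which occurs at the latest at the given witness.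
least : {P : ℕ → Set} → (∀ k → Dec (P k)) → ∀ {k} → P k → ∃ (Least P)
least {P} P? {k} p = scan 0 k (λ _ ()) (subst P (sym (+-identityʳ k)) p)
  where
    scan : ∀ i fuel → (∀ j → j < i → ¬ P j) → P (fuel + i) → ∃ (Least P)
    scan i zero below p = i , p , below
    scan i (suc fuel) below p with P? i
    ... | yes pᵢ = i , pᵢ , below
    ... | no ¬pᵢ = scan (suc i) fuel below′ (subst P (sym (+-suc fuel i)) p)
      where
        below′ : ∀ j → j < suc i → ¬ P j
        below′ j j<1+i = [ below j , (λ { refl → ¬pᵢ }) ] (m<1+n⇒m<n∨m≡n j<1+i)

least-≤ : ∀ {P : ℕ → Set} {k l} → Least P k → P l → k ≤ l
least-≤ {l = l} (_ , below) pₗ = ≮⇒≥ (λ l<k → below l l<k pₗ)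

data Step : ℕ → ℕ → Set where
  up   : ∀ {a} → Step a (suc a)
  down : ∀ {a} → Step (suc a) a

Peak : ℕ → ℕ → ℕ → Set
Peak a b c = b ≡ suc a × b ≡ suc c

mod3 : ℕ → Fin 3
mod3 0 = zero
mod3 1 = suc zero
mod3 2 = suc (suc zero)
mod3 (suc (suc (suc a))) = mod3 a

mod3-gap₁ : ∀ a → mod3 a ≢ mod3 (suc a)
mod3-gap₁ 0 ()
mod3-gap₁ 1 ()
mod3-gap₁ 2 ()
mod3-gap₁ (suc (suc (suc a))) = mod3-gap₁ a

mod3-gap₂ : ∀ a → mod3 a ≢ mod3 (suc (suc a))
mod3-gap₂ 0 ()
mod3-gap₂ 1 ()
mod3-gap₂ 2 ()
mod3-gap₂ (suc (suc (suc a))) = mod3-gap₂ a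

⊔-up : ∀ a → a ⊔ suc a ≡ suc a
⊔-up a = m≤n⇒m⊔n≡n (n≤1+n a)

⊔-down : ∀ a → suc a ⊔ a ≡ suc a
⊔-down a = m≥n⇒m⊔n≡m (n≤1+n a)

-- Along a peak-free profile a, b, c, e the levels (maxima) of the first and
-- last step differ by 1 or 2, so their residues mod 3 differ.  The four
-- peak-free shapes are up-up-up, down-up-up, down-down-up, down-down-down.
outer-levels-differ : ∀ {a b c e} → Step a b → Step b c → Step c e →
                      ¬ Peak a b c → ¬ Peak b c e → mod3 (a ⊔ b) ≢ mod3 (c ⊔ e)
outer-levels-differ up   down _    no-peak₁ _ = ⊥-elim (no-peak₁ (refl , refl))
outer-levels-differ _    up   down _ no-peak₂ = ⊥-elim (no-peak₂ (refl , refl))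
outer-levels-differ {a} up up up _ _
  rewrite ⊔-up a = mod3-gap₂ (suc a)
outer-levels-differ {suc a} down up up _ _
  rewrite ⊔-down a | ⊔-up a = mod3-gap₁ (suc a)
outer-levels-differ {suc (suc a)} down down up _ _
  rewrite ⊔-down a | ⊔-up a = mod3-gap₁ (suc a) ∘ sym
outer-levels-differ {suc (suc (suc a))} down down down _ _
  rewrite ⊔-down a = mod3-gap₂ (suc a) ∘ sym

module RootedTree {n : ℕ} (G : SimpleGraph n) (connected : Connected G) (acyclic : Acyclic G)
                  (root : Fin n) where
  open Paths G

  adj? : ∀ x y → Dec (Adj G x y)
  adj? = adjacency-decidable connected acyclic

  ReachIn : ℕ → Fin n → Set
  ReachIn zero    v = v ≡ root
  ReachIn (suc k) v = ∃[ w ] (Adj G v w × ReachIn k w)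

  reachIn? : ∀ k v → Dec (ReachIn k v)
  reachIn? zero    v = v ≟ root
  reachIn? (suc k) v = any? (λ w → adj? v w ×-dec reachIn? k w)

  walk-length : ∀ {v} → Star (Adj G) v root → ∃[ k ] ReachIn k v
  walk-length ε = zero , refl
  walk-length (e ◅ walk) = let (k , r) = walk-length walk in suc k , (_ , e , r)

  depth-spec : ∀ v → ∃ (Least (λ k → ReachIn k v))
  depth-spec v = least (λ k → reachIn? k v) (proj₂ (walk-length (connected v root)))

  depth : Fin n → ℕ
  depth v = proj₁ (depth-spec v)

  reaches-at-depth : ∀ v → ReachIn (depth v) v
  reaches-at-depth v = proj₁ (proj₂ (depth-spec v))

  depth-≤ : ∀ {k v} → ReachIn k v → depth v ≤ k
  depth-≤ {v = v} = least-≤ (proj₂ (depth-spec v))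

  depth-adj : ∀ {v w} → Adj G v w → depth v ≤ suc (depth w)
  depth-adj {w = w} e = depth-≤ (w , e , reaches-at-depth w)

  parent : ∀ {v k} → depth v ≡ suc k → ∃[ w ] (Adj G v w × depth w ≡ k)
  parent {v} {k} dv with subst (λ j → ReachIn j v) dv (reaches-at-depth v)
  ... | w , e , reach =
    w , e , ≤-antisym (depth-≤ reach) (≤-pred (subst (_≤ suc (depth w)) dv (depth-adj e)))

  depth-zero : ∀ {v} → depth v ≡ 0 → v ≡ root
  depth-zero {v} dv = subst (λ j → ReachIn j v) dv (reaches-at-depth v)

  Above : ℕ → ∀ {m a c} → Path m a c → Set
  Above k P = ∀ i → k ≤ depth (vertex P i)

  avoids-lower : ∀ {k m a c w} {P : Path m a c} → Above (suc k) P → depth w ≡ k → Avoids P w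
  avoids-lower above dw i refl = <⇒≢ (above i) (sym dw)

  -- Two distinct vertices of equal depth k are never joined by a path that
  -- stays at depth ≥ k.  Otherwise extend it by the parents of both ends: if
  -- the parents coincide this closes a cycle, if not we get such a path one
  -- level higher up, and at level 0 both ends would be the root.
  no-path-above : ∀ k {m x z} → depth x ≡ k → depth z ≡ k → z ≢ x →
                  (P : Path (suc m) z x) → Above k P → ⊥
  no-path-above zero dx dz z≢x P _ = z≢x (trans (depth-zero dz) (sym (depth-zero dx)))
  no-path-above (suc k) {x = x} dx dz z≢x P above with parent dx | parent dz
  ... | px , x~px , dpx | pz , z~pz , dpz = climb (px ≟ pz)
    where
      P₁ : Path _ pz x
      P₁ = cons (adj-sym G z~pz) P (avoids-lower {P = P} above dpz)

      above₁ : Above k P₁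
      above₁ zero    = ≤-reflexive (sym dpz)
      above₁ (suc i) = ≤-trans (n≤1+n k) (above i)

      climb : Dec (px ≡ pz) → ⊥
      climb (yes px≡pz) = closes-cycle acyclic P₁ (subst (Adj G x) px≡pz x~px)
      climb (no px≢pz)  = no-path-above k dpz dpx px≢pz P₂ above₂
        where
          px∉P₁ : Avoids P₁ px
          px∉P₁ zero    = px≢pz ∘ sym
          px∉P₁ (suc i) = avoids-lower {P = P} above dpx i

          P₂ : Path _ px pz
          P₂ = cons (adj-sym G x~px) (reverse P₁) (px∉P₁ ∘ opposite)

          above₂ : Above k P₂
          above₂ zero    = ≤-reflexive (sym dpx)
          above₂ (suc i) = above₁ (opposite i)

  adjacent-depths-differ : ∀ {x z} → Adj G x z → depth x ≢ depth z
  adjacent-depths-differ {x} {z} e dx≡dz =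
    no-path-above (depth x) refl (sym dx≡dz) (adj-distinct e ∘ sym) edge above
    where
      edge : Path 1 z x
      edge = cons (adj-sym G e) (trivial x) (λ { zero → adj-distinct e })
      above : Above (depth x) edge
      above zero       = ≤-reflexive dx≡dz
      above (suc zero) = ≤-reflexive refl

  no-peak : ∀ {x y z} → Adj G y x → Adj G y z → x ≢ z → ¬ Peak (depth x) (depth y) (depth z)
  no-peak {x} {y} {z} y~x y~z x≢z (dy≡1+dx , dy≡1+dz) =
    no-path-above (depth x) refl dz≡dx (x≢z ∘ sym) P above
    where
      dz≡dx : depth z ≡ depth x
      dz≡dx = suc-injective (trans (sym dy≡1+dz) dy≡1+dx)
      P : Path 2 z x
      P = cons (adj-sym G y~z) (cons y~x (trivial x) (λ { zero → adj-distinct y~x ∘ sym }))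
               (λ { zero → adj-distinct y~z ; (suc zero) → x≢z })
      above : Above (depth x) P
      above zero             = ≤-reflexive (sym dz≡dx)
      above (suc zero)       = ≤-trans (n≤1+n (depth x)) (≤-reflexive (sym dy≡1+dx))
      above (suc (suc zero)) = ≤-reflexive refl

  depth-step : ∀ {x y} → Adj G x y → Step (depth x) (depth y)
  depth-step {x} {y} e with <-cmp (depth x) (depth y)
  ... | tri< dx<dy _ _ = subst (Step (depth x)) (≤-antisym dx<dy (depth-adj (adj-sym G e))) up
  ... | tri≈ _ dx≡dy _ = ⊥-elim (adjacent-depths-differ e dx≡dy)
  ... | tri> _ _ dy<dx = subst (λ a → Step a (depth y)) (≤-antisym dy<dx (depth-adj e)) down

  depth-colouring : EdgeColoring G 3
  depth-colouring = record
    { col  = λ x y _ → mod3 (depth x ⊔ depth y)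
    ; symm = λ x y _ _ → cong mod3 (⊔-comm (depth x) (depth y)) }

  -- For consecutive edges xy, yz, zu the depth profile has no peak at y
  -- (as x ≠ z) nor at z (as y ≠ u), so the outer colours differ.
  depth-colouring-injective : IsInjective depth-colouring
  depth-colouring-injective x y z u x~y y~z z~u x≢z y≢u =
    outer-levels-differ (depth-step x~y) (depth-step y~z) (depth-step z~u)
                        (no-peak (adj-sym G x~y) y~z x≢z) (no-peak (adj-sym G y~z) z~u y≢u)

col-irrelevant : ∀ {n k} {G : SimpleGraph n} (c : EdgeColoring G k) x y (p q : Adj G x y) →
                 col c x y p ≡ col c x y q
col-irrelevant {G = G} c x y p q = trans (symm c x y p (adj-sym G p)) (sym (symm c x y q (adj-sym G p)))

Searchable : Set → Set₁
Searchable A = (P : A → Set) → (∀ a → Dec (P a)) → Dec (∃ P)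

searchable-Fin : ∀ {k} → Searchable (Fin k)
searchable-Fin _ = any?

searchable-Vec : ∀ {A} → Searchable A → ∀ m → Searchable (Vec A m)
searchable-Vec search zero P P? with P? []
... | yes p = yes ([] , p)
... | no ¬p = no λ { ([] , p) → ¬p p }
searchable-Vec search (suc m) P P?
  with search (λ a → ∃ λ v → P (a ∷ v)) (λ a → searchable-Vec search m (P ∘ (a ∷_)) (P? ∘ (a ∷_)))
... | yes (a , v , p) = yes (a ∷ v , p)
... | no ¬p = no λ { (a ∷ v , p) → ¬p (a , v , p) }

-- With decidable adjacency, injective colourability is decidable: search all
-- tables of colours indexed by pairs of vertices.
module Colourability {n : ℕ} (G : SimpleGraph n) (adj? : ∀ x y → Dec (Adj G x y)) where

  Table : ℕ → Set
  Table k = Vec (Vec (Fin k) n) n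

  entry : ∀ {k} → Table k → Fin n → Fin n → Fin k
  entry T x y = lookup (lookup T x) y

  Valid : ∀ {k} → Table k → Set
  Valid T = (∀ x y → Adj G x y → entry T x y ≡ entry T y x)
          × (∀ x y z u → Adj G x y → Adj G y z → Adj G z u → x ≢ z → y ≢ u →
             entry T x y ≢ entry T z u)

  valid? : ∀ {k} (T : Table k) → Dec (Valid T)
  valid? T =
    all? (λ x → all? λ y → adj? x y →-dec (entry T x y ≟ entry T y x))
    ×-dec
    all? (λ x → all? λ y → all? λ z → all? λ u →
      adj? x y →-dec (adj? y z →-dec (adj? z u →-dec
        (¬? (x ≟ z) →-dec (¬? (y ≟ u) →-dec ¬? (entry T x y ≟ entry T z u))))))

  from-table : ∀ {k} → Σ (Table k) Valid → InjColorable G k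
  from-table (T , symmetric , injective) =
    record { col = λ x y _ → entry T x y ; symm = λ x y p _ → symmetric x y p } , injective

  to-table : ∀ {k} → InjColorable G (suc k) → Σ (Table (suc k)) Valid
  to-table {k} (c , injective) = T , symmetric , injective′
    where
      colour : Fin n → Fin n → Fin (suc k)
      colour x y with adj? x y
      ... | yes p = col c x y p
      ... | no _  = zero

      T : Table (suc k)
      T = tabulate (tabulate ∘ colour)

      entry-edge : ∀ x y (p : Adj G x y) → entry T x y ≡ col c x y p
      entry-edge x y p
        rewrite lookup∘tabulate (tabulate ∘ colour) x | lookup∘tabulate (colour x) y
        with adj? x y
      ... | yes p′ = col-irrelevant c x y p′ p
      ... | no ¬p  = ⊥-elim (¬p p)

      symmetric : ∀ x y → Adj G x y → entry T x y ≡ entry T y x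
      symmetric x y p = trans (entry-edge x y p)
                          (trans (symm c x y p (adj-sym G p)) (sym (entry-edge y x (adj-sym G p))))

      injective′ : ∀ x y z u → Adj G x y → Adj G y z → Adj G z u → x ≢ z → y ≢ u →
                   entry T x y ≢ entry T z u
      injective′ x y z u p q r x≢z y≢u same =
        injective x y z u p q r x≢z y≢u (trans (sym (entry-edge x y p)) (trans same (entry-edge z u r)))

  injColourable? : ∀ k → Dec (InjColorable G (suc k))
  injColourable? k =
    map′ from-table to-table (searchable-Vec (searchable-Vec searchable-Fin n) n Valid valid?)

injective-chromatic-index : ∀ {n k} {G : SimpleGraph n} → (∀ j → Dec (InjColorable G j)) →
                            InjColorable G k → ∃[ i ] (IsInjChromaticIndex G i × i ≤ k)
injective-chromatic-index colourable? c =
  let (i , index) = least colourable? c in i , index , least-≤ index c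

-- A connected graph with two distinct vertices has an edge, which needs a colour.
no-colouring-without-colours : ∀ {n} {G : SimpleGraph n} → Connected G →
                               {x y : Fin n} → x ≢ y → ¬ InjColorable G 0
no-colouring-without-colours connected {x} {y} x≢y (c , _) with connected x y
... | ε = x≢y refl
... | e ◅ _ with col c _ _ e
... | ()

index-positive : ∀ {n k} {G : SimpleGraph n} → ¬ InjColorable G 0 → IsInjChromaticIndex G k → 1 ≤ k
index-positive {k = zero}  no-0 (c , _) = contradiction c no-0
index-positive {k = suc k} _    _       = s≤s z≤n

proposition12 : (n : ℕ) → 2 ≤ n → (T : SimpleGraph n) → IsTree T →
                  ∃[ k ] (IsInjChromaticIndex T k × 1 ≤ k × k ≤ 3)
proposition12 (suc (suc n)) (s≤s (s≤s _)) T (connected , acyclic) =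
  let (k , index , k≤3) = injective-chromatic-index colourable? three-colours
  in  k , index , index-positive no-0 index , k≤3
  where
    open RootedTree T connected acyclic zero

    three-colours : InjColorable T 3
    three-colours = depth-colouring , depth-colouring-injective

    no-0 : ¬ InjColorable T 0
    no-0 = no-colouring-without-colours connected {zero} {suc zero} (λ ())

    colourable? : ∀ j → Dec (InjColorable T j)
    colourable? zero    = no no-0
    colourable? (suc j) = Colourability.injColourable? T adj? j
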